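{- Let $G$ be a finite simple chordal graph on the vertex set $\{x_1,\ldots,x_n\}$, $R=\mathbb K[x_1,\ldots,x_n]$ over a field $\mathbb K$, $t\ge 2$, and let $x\in V(G)$ be a simplicial vertex. Let $\mathcal A_x=\{C\subseteq V(G) : |C|=t-1,\ x\in C,\ G[C]\text{ connected}\}$, enumerated (in any order) as $\mathcal A_x=\{C_1,\ldots,C_k\}$. Set $\mathcal B_{C_1}=N_G(C_1)$ and, for $2\le i\le k$, \[\mathcal B_{C_i}=\{w\in N_G(C_i)\mid C_i\cup\{w\}\neq C_j\cup\{w'\}\text{ for all }1\le j\le i-1\text{ and all } w'\in N_G(C_j)\}.\] For $1\le i\le k$ define $J_i=\mathbf x_{C_i}\langle w\mid w\in\mathcal B_{C_i}\rangle$ and $K_i=I(\mathcal H(G,t)\setminus\{C_1,\ldots,C_i\})$. If $\mathcal B_{C_i}\neq\emptyset$, then: (1) $J_i+K_i=I(\mathcal H(G,t)\setminus\{C_1,\ldots,C_{i-1}\})$ (for $i=1$ this is $I(\mathcal H(G,t))=J_t(G)$); (2) $J_i\cap K_i=\mathbf x_{C_i}L_i$, where $L_i=\left\langle \frac{\mathrm{lcm}(m,m')}{\mathbf x_{C_i}} \;\middle|\; m\in J_i,\ m'\in K_i \text{ monomials}\right\rangle$; moreover, for every $w\in\mathcal B_{C_i}$ one has $(L_i:w)=M_i+N_i+Q_i$, where $M_i=\langle v\mid v\in N_G(C_i)\setminus\{w\}\rangle$, $N_i=\langle v\mid v\in N_G(w)\setminus N_G[C_i]\rangle$, $Q_i=\langle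 \mathbf x_C\mid C\subseteq V(G),\ |C|=t,\ G[C]\text{ connected},\ C\cap(N_G[C_i]\cup N_G[w])=\emptyset\rangle$.
   Context: A graph is chordal if it has no induced cycle of length greater than three; a vertex is simplicial if its neighbourhood induces a complete graph. $G[W]$ is the induced subgraph on $W$; $\mathbf x_F=\prod_{x_i\in F}x_i$. $N_G(C)=\{v\in V(G)\setminus C\mid \{v,u\}\in E(G)\text{ for some }u\in C\}$, $N_G[C]=N_G(C)\cup C$, $N_G[w]=N_G(w)\cup\{w\}$. $\mathcal H(G,t)$ is the hypergraph with vertex set $V(G)$ whose edges are the $t$-subsets $C\subseteq V(G)$ with $G[C]$ connected, and $J_t(G)=I(\mathcal H(G,t))$, where the edge ideal of a hypergraph $\mathcal H$ is $I(\mathcal H)=\langle \mathbf x_{\mathcal E}\mid \mathcal E\in E(\mathcal H)\rangle$. For subsets $C_1,\ldots,C_r$ of $V(\mathcal H)$, $\mathcal H\setminus\{C_1,\ldots,C_r\}$ is the hypergraph with the same vertex set and edge set $E(\mathcal H)\setminus\{\mathcal E\in E(\mathcal H)\mid C_j\subseteq\mathcal E\text{ for some }j\}$. -}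

module Defs where

open import Data.Nat using (ℕ; zero; suc; _+_; _∸_; _⊔_; _≤_)
open import Data.Fin using (Fin; toℕ) renaming (_<_ to _<ᶠ_)
open import Data.Fin.Subset using (Subset; _∈_; _∉_; _⊆_; _∪_; ⁅_⁆; ∣_∣)
open import Data.Vec using (lookup)
open import Data.Bool using (if_then_else_)
open import Data.Product using (Σ; _×_; _,_; ∃)
open import Data.Sum using (_⊎_)
open import Relation.Binary.PropositionalEquality using (_≡_; _≢_)
open import Relation.Nullary using (¬_; Dec)

-- Finite simple graphs on the vertex set Fin n  (vertex i = x_{i+1})

record Graph (n : ℕ) : Set₁ where
  field
    Adj   : Fin n → Fin n → Set
    adj?  : (u v : Fin n) → Dec (Adj u v)
    sym   : ∀ {u v} → Adj u v → Adj v u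
    irrefl : ∀ {u} → ¬ Adj u u
open Graph public

_⇔_ : Set → Set → Set
A ⇔ B = (A → B) × (B → A)

module _ {n : ℕ} (G : Graph n) where

  CycAdj : (k : ℕ) → Fin k → Fin k → Set
  CycAdj k i j = (toℕ j ≡ suc (toℕ i)) ⊎ (toℕ i ≡ suc (toℕ j))
               ⊎ ((toℕ i ≡ 0) × (suc (toℕ j) ≡ k))
               ⊎ ((toℕ j ≡ 0) × (suc (toℕ i) ≡ k))

  InducedCycle : (k : ℕ) → (Fin k → Fin n) → Set
  InducedCycle k f = (∀ i j → f i ≡ f j → i ≡ j)
                   × (∀ i j → Adj G (f i) (f j) ⇔ CycAdj k i j)

  Chordal : Set
  Chordal = ∀ k (f : Fin k → Fin n) → 4 ≤ k → ¬ InducedCycle k f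

  Simplicial : Fin n → Set
  Simplicial x = ∀ u v → Adj G x u → Adj G x v → u ≢ v → Adj G u v

  data WalkIn (C : Subset n) : Fin n → Fin n → Set where
    here : ∀ {u} → u ∈ C → WalkIn C u u
    step : ∀ {u v w} → u ∈ C → Adj G u v → WalkIn C v w → WalkIn C u w

  Connected : Subset n → Set
  Connected C = ∀ u v → u ∈ C → v ∈ C → WalkIn C u v

  InN : Fin n → Subset n → Set
  InN v C = v ∉ C × ∃ λ u → u ∈ C × Adj G v u

  InNc : Fin n → Subset n → Set
  InNc v C = InN v C ⊎ v ∈ C

  InNv : Fin n → Fin n → Set
  InNv v w = Adj G v w ⊎ v ≡ w

  IsEdgeH : ℕ → Subset n → Set
  IsEdgeH t C = ∣ C ∣ ≡ t × Connected C

-- Monomials in x_1,…,x_n (exponent vectors) and monomial ideals.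
-- A monomial ideal is represented by the set of monomials it contains.

Mon : ℕ → Set
Mon n = Fin n → ℕ

MonIdeal : ℕ → Set₁
MonIdeal n = Mon n → Set

module _ {n : ℕ} where

  _∣ᵐ_ : Mon n → Mon n → Set
  a ∣ᵐ b = ∀ i → a i ≤ b i

  _*ᵐ_ : Mon n → Mon n → Mon n
  (a *ᵐ b) i = a i + b i

  lcmᵐ : Mon n → Mon n → Mon n
  lcmᵐ a b i = a i ⊔ b i

  -- exact quotient a / b (used only when b ∣ a)
  _/ᵐ_ : Mon n → Mon n → Mon n
  (a /ᵐ b) i = a i ∸ b i

  var : Fin n → Mon n
  var v i = if lookup (⁅ v ⁆) i then 1 else 0

  xS : Subset n → Mon n
  xS C i = if lookup C i then 1 else 0

  _≐_ : MonIdeal n → MonIdeal n → Set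
  I ≐ J = ∀ m → I m ⇔ J m

  _+ᴵ_ : MonIdeal n → MonIdeal n → MonIdeal n
  (I +ᴵ J) m = I m ⊎ J m

  _∩ᴵ_ : MonIdeal n → MonIdeal n → MonIdeal n
  (I ∩ᴵ J) m = I m × J m

  _·ᴵ_ : Mon n → MonIdeal n → MonIdeal n
  (a ·ᴵ I) m = ∃ λ g → I g × (a *ᵐ g) ∣ᵐ m

  _∶var_ : MonIdeal n → Fin n → MonIdeal n
  (I ∶var w) m = I (var w *ᵐ m)

module _ {n : ℕ} (G : Graph n) where

  -- I(H(G,t) ∖ {Cs j | P j})  where Cs : Fin k → Subset n, P selects indices
  IHminus : ℕ → {k : ℕ} → (Fin k → Subset n) → (Fin k → Set) → MonIdeal n
  IHminus t Cs P m = ∃ λ E → IsEdgeH G t E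
                           × (∀ j → P j → ¬ (Cs j ⊆ E))
                           × xS E ∣ᵐ m

  InA : ℕ → Fin n → Subset n → Set
  InA t x C = ∣ C ∣ ≡ t ∸ 1 × x ∈ C × Connected G C

  InB : {k : ℕ} → (Fin k → Subset n) → Fin k → Fin n → Set
  InB Cs i w = InN G w (Cs i)
             × (∀ j → j <ᶠ i → ∀ w' → InN G w' (Cs j) → Cs i ∪ ⁅ w ⁆ ≢ Cs j ∪ ⁅ w' ⁆)

  Jᵢ : {k : ℕ} → (Fin k → Subset n) → Fin k → MonIdeal n
  Jᵢ Cs i m = ∃ λ w → InB Cs i w × (xS (Cs i) *ᵐ var w) ∣ᵐ m

  Kᵢ : ℕ → {k : ℕ} → (Fin k → Subset n) → Fin k → MonIdeal n
  Kᵢ t Cs i = IHminus t Cs (λ j → j <ᶠ i ⊎ j ≡ i)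

  Prevᵢ : ℕ → {k : ℕ} → (Fin k → Subset n) → Fin k → MonIdeal n
  Prevᵢ t Cs i = IHminus t Cs (λ j → j <ᶠ i)

  Lᵢ : ℕ → {k : ℕ} → (Fin k → Subset n) → Fin k → MonIdeal n
  Lᵢ t Cs i m = ∃ λ a → ∃ λ b → Jᵢ Cs i a × Kᵢ t Cs i b
                 × (lcmᵐ a b /ᵐ xS (Cs i)) ∣ᵐ m

  Mᵢ : {k : ℕ} → (Fin k → Subset n) → Fin k → Fin n → MonIdeal n
  Mᵢ Cs i w m = ∃ λ v → InN G v (Cs i) × v ≢ w × var v ∣ᵐ m

  Nᵢ : {k : ℕ} → (Fin k → Subset n) → Fin k → Fin n → MonIdeal n
  Nᵢ Cs i w m = ∃ λ v → Adj G v w × ¬ InNc G v (Cs i) × var v ∣ᵐ m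

  Qᵢ : ℕ → {k : ℕ} → (Fin k → Subset n) → Fin k → Fin n → MonIdeal n
  Qᵢ t Cs i w m = ∃ λ C → IsEdgeH G t C
                   × (∀ v → v ∈ C → ¬ InNc G v (Cs i) × ¬ InNv G v w)
                   × xS C ∣ᵐ m

{-# OPTIONS --safe #-}
module Submission where

-- Write C = Cᵢ, so x ∈ C and |C| = t − 1. A connected t-set E ⊇ C is C ∪ {w} for a
-- neighbour w of C: a walk inside E from the extra vertex to x must enter C through it.
-- Hence the generators of J_t(G) whose support contains C are exactly the 𝐱_C x_w with
-- w ∈ N(C), and the condition defining 𝓑_{Cᵢ} says precisely that C ∪ {w} contains no
-- earlier C_j; this gives (1). The first half of (2) holds for any monomial ideals
-- I, K with 𝐱_C dividing every element of I.
-- For the colon ideal, if x_w m ∈ Lᵢ then every vertex outside C ∪ {w} used by the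
-- two witnesses divides m. Either the witness edge E meets N(C ∪ {w}), giving a variable
-- of Mᵢ or Nᵢ, or E is disjoint from N[C ∪ {w}]: otherwise connectivity would trap E
-- inside C ∪ {w}, a set of the same size, forcing C ⊆ E. This gives a generator of Qᵢ.
-- Conversely, for v ∈ N(C ∪ {w}) the set (C ∪ {w, v}) ∖ {x} is again a connected t-set,
-- because x is simplicial. It misses x, so it contains no C_j, and it witnesses
-- x_v ∈ (Lᵢ : x_w).

open import Defs
open import Data.Nat using (ℕ; suc; _≤_; _<_; _+_; z≤n; s≤s)
open import Data.Nat.Properties
  using (≤-refl; ≤-reflexive; ≤-trans; <⇒≱; m≤m+n; m≤n+m; +-mono-≤; +-monoʳ-≤; +-assoc;
         +-identityʳ; m≤n+o⇒m∸n≤o; m≤n+m∸n; m+[n∸m]≡n; ⊔-lub; m≤m⊔n; m≤n⊔m; suc-injective)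
open import Data.Fin using (Fin; zero; suc) renaming (_<_ to _<ᶠ_)
open import Data.Fin.Properties using (any?) renaming (_≟_ to _≟ᶠ_)
open import Data.Fin.Subset using (Subset; _∈_; _∉_; _⊆_; _∪_; ⁅_⁆; ∣_∣; _-_; inside; outside)
open import Data.Fin.Subset.Properties
  using (_∈?_; _⊆?_; p⊆q⇒∣p∣≤∣q∣; p⊂q⇒∣p∣<∣q∣; ⊆-antisym; x∈p∪q⁻; p⊆p∪q; q⊆p∪q; x∈⁅x⁆;
         x∈⁅y⁆⇒x≡y; x≢y⇒x∉⁅y⁆; p─q⊆p; p─⊥≡p; x∈p∧x≢y⇒x∈p-y; ∪-identityʳ)
open import Data.Vec using (_∷_; here; there; lookup)
open import Data.Vec.Properties using ([]=⇒lookup; lookup⇒[]=)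
open import Data.Bool using (true; false)
open import Data.Product using (_×_; ∃; _,_; proj₁; proj₂; uncurry)
open import Data.Sum using (_⊎_; inj₁; inj₂; [_,_]′)
open import Function using (_∘_; id)
open import Relation.Nullary using (¬_; Dec; yes; no; contradiction)
open import Relation.Nullary.Decidable using (_×-dec_; ¬?; decidable-stable)
open import Relation.Binary.PropositionalEquality as ≡ using (_≡_; _≢_; refl; trans; cong; cong₂; subst)

private
  variable
    n : ℕ
    p q : Subset n
    u v w y : Fin n
    a b c d m : Mon n

x∈p∪⁅y⁆⁻ : u ∈ p ∪ ⁅ y ⁆ → u ∈ p ⊎ u ≡ y
x∈p∪⁅y⁆⁻ {p = p} {y = y} u∈ = [ inj₁ , inj₂ ∘ x∈⁅y⁆⇒x≡y y ]′ (x∈p∪q⁻ p ⁅ y ⁆ u∈)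

p⊆p∪⁅y⁆ : p ⊆ p ∪ ⁅ y ⁆
p⊆p∪⁅y⁆ {y = y} = p⊆p∪q ⁅ y ⁆

y∈p∪⁅y⁆ : y ∈ p ∪ ⁅ y ⁆
y∈p∪⁅y⁆ {y = y} {p = p} = q⊆p∪q p ⁅ y ⁆ (x∈⁅x⁆ y)

x∉p∪⁅y⁆ : u ∉ p → u ≢ y → u ∉ p ∪ ⁅ y ⁆
x∉p∪⁅y⁆ u∉p u≢y u∈ = [ u∉p , u≢y ]′ (x∈p∪⁅y⁆⁻ u∈)

x∉p∪⁅y⁆⁻ : u ∉ p ∪ ⁅ y ⁆ → u ∉ p × u ≢ y
x∉p∪⁅y⁆⁻ u∉ = u∉ ∘ p⊆p∪⁅y⁆ , λ { refl → u∉ y∈p∪⁅y⁆ }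

x∉p-x : (p : Subset n) (x : Fin n) → x ∉ p - x
x∉p-x (_ ∷ p) zero    ()
x∉p-x (_ ∷ p) (suc x) (there x∈p-x) = x∉p-x p x x∈p-x

∣p∪⁅x⁆∣≡1+∣p∣ : (p : Subset n) (x : Fin n) → x ∉ p → ∣ p ∪ ⁅ x ⁆ ∣ ≡ suc ∣ p ∣
∣p∪⁅x⁆∣≡1+∣p∣ (inside  ∷ p) zero    x∉p = contradiction here x∉p
∣p∪⁅x⁆∣≡1+∣p∣ (outside ∷ p) zero    _   = cong (suc ∘ ∣_∣) (∪-identityʳ p)
∣p∪⁅x⁆∣≡1+∣p∣ (inside  ∷ p) (suc x) x∉p = cong suc (∣p∪⁅x⁆∣≡1+∣p∣ p x (x∉p ∘ there))
∣p∪⁅x⁆∣≡1+∣p∣ (outside ∷ p) (suc x) x∉p = ∣p∪⁅x⁆∣≡1+∣p∣ p x (x∉p ∘ there)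

x∈p⇒1+∣p-x∣≡∣p∣ : (p : Subset n) (x : Fin n) → x ∈ p → suc ∣ p - x ∣ ≡ ∣ p ∣
x∈p⇒1+∣p-x∣≡∣p∣ (inside  ∷ p) zero    here          = cong (suc ∘ ∣_∣) (p─⊥≡p p)
x∈p⇒1+∣p-x∣≡∣p∣ (inside  ∷ p) (suc x) (there x∈p) = cong suc (x∈p⇒1+∣p-x∣≡∣p∣ p x x∈p)
x∈p⇒1+∣p-x∣≡∣p∣ (outside ∷ p) (suc x) (there x∈p) = x∈p⇒1+∣p-x∣≡∣p∣ p x x∈p

∣p∣<∣q∣⇒∃[x∈q∖p] : ∣ p ∣ < ∣ q ∣ → ∃ λ x → x ∈ q × x ∉ p
∣p∣<∣q∣⇒∃[x∈q∖p] {p = p} {q = q} ∣p∣<∣q∣ with any? (λ x → x ∈? q ×-dec ¬? (x ∈? p))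
... | yes found = found
... | no none = contradiction (p⊆q⇒∣p∣≤∣q∣ q⊆p) (<⇒≱ ∣p∣<∣q∣)
  where
  q⊆p : q ⊆ p
  q⊆p {x} x∈q = decidable-stable (x ∈? p) (λ x∉p → none (x , x∈q , x∉p))

p⊆q∧∣q∣≤∣p∣⇒q⊆p : p ⊆ q → ∣ q ∣ ≤ ∣ p ∣ → q ⊆ p
p⊆q∧∣q∣≤∣p∣⇒q⊆p {p = p} p⊆q ∣q∣≤∣p∣ {x} x∈q = decidable-stable (x ∈? p) λ x∉p →
  <⇒≱ (p⊂q⇒∣p∣<∣q∣ (p⊆q , x , x∈q , x∉p)) ∣q∣≤∣p∣

∣ᵐ-refl : a ∣ᵐ a
∣ᵐ-refl _ = ≤-refl

∣ᵐ-trans : a ∣ᵐ b → b ∣ᵐ c → a ∣ᵐ c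
∣ᵐ-trans a∣b b∣c l = ≤-trans (a∣b l) (b∣c l)

*ᵐ-mono-∣ᵐ : a ∣ᵐ b → c ∣ᵐ d → (a *ᵐ c) ∣ᵐ (b *ᵐ d)
*ᵐ-mono-∣ᵐ a∣b c∣d l = +-mono-≤ (a∣b l) (c∣d l)

a∣ᵐa*ᵐb : (a b : Mon n) → a ∣ᵐ (a *ᵐ b)
a∣ᵐa*ᵐb a b l = m≤m+n (a l) (b l)

b∣ᵐa*ᵐb : (a b : Mon n) → b ∣ᵐ (a *ᵐ b)
b∣ᵐa*ᵐb a b l = m≤n+m (b l) (a l)

*ᵐ-assoc-∣ᵐ : (a b c : Mon n) → ((a *ᵐ b) *ᵐ c) ∣ᵐ (a *ᵐ (b *ᵐ c))
*ᵐ-assoc-∣ᵐ a b c l = ≤-reflexive (+-assoc (a l) (b l) (c l))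

lcmᵐ-least : a ∣ᵐ m → b ∣ᵐ m → lcmᵐ a b ∣ᵐ m
lcmᵐ-least a∣m b∣m l = ⊔-lub (a∣m l) (b∣m l)

a∣ᵐlcmᵐ : a ∣ᵐ lcmᵐ a b
a∣ᵐlcmᵐ {a = a} {b = b} l = m≤m⊔n (a l) (b l)

b∣ᵐlcmᵐ : b ∣ᵐ lcmᵐ a b
b∣ᵐlcmᵐ {b = b} {a = a} l = m≤n⊔m (a l) (b l)

-- No hypothesis c ∣ᵐ a is needed, because /ᵐ truncates.
/ᵐ-∣ᵐ⇔∣ᵐ-*ᵐ : ∀ a c → ((a /ᵐ c) ∣ᵐ m) ⇔ (a ∣ᵐ (c *ᵐ m))
/ᵐ-∣ᵐ⇔∣ᵐ-*ᵐ a c =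
  (λ a/c∣m l → ≤-trans (m≤n+m∸n (a l) (c l)) (+-monoʳ-≤ (c l) (a/c∣m l))) ,
  (λ a∣cm l → m≤n+o⇒m∸n≤o (a l) (c l) (a∣cm l))

*ᵐ-/ᵐ-cancel : c ∣ᵐ m → (c *ᵐ (m /ᵐ c)) ∣ᵐ m
*ᵐ-/ᵐ-cancel c∣m l = ≤-reflexive (m+[n∸m]≡n (c∣m l))

xS-∈ : u ∈ p → xS p u ≡ 1
xS-∈ {p = p} u∈p rewrite []=⇒lookup u∈p = refl

xS-∉ : u ∉ p → xS p u ≡ 0
xS-∉ {u = u} {p = p} u∉p with lookup p u in eq
... | true  = contradiction (lookup⇒[]= u p eq) u∉p
... | false = refl

xS-∣ᵐ⁺ : (∀ l → l ∈ p → 1 ≤ m l) → xS p ∣ᵐ m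
xS-∣ᵐ⁺ {p = p} support l with lookup p l in eq
... | true  = support l (lookup⇒[]= l p eq)
... | false = z≤n

xS-∣ᵐ⁻ : xS p ∣ᵐ m → u ∈ p → 1 ≤ m u
xS-∣ᵐ⁻ {u = u} p∣m u∈p = ≤-trans (≤-reflexive (≡.sym (xS-∈ u∈p))) (p∣m u)

var-∣ᵐ : 1 ≤ m v → var v ∣ᵐ m
var-∣ᵐ {m = m} {v = v} 1≤mv = xS-∣ᵐ⁺ λ l l∈⁅v⁆ → subst (λ u → 1 ≤ m u) (≡.sym (x∈⁅y⁆⇒x≡y v l∈⁅v⁆)) 1≤mv

xS-mono : p ⊆ q → xS p ∣ᵐ xS q
xS-mono p⊆q = xS-∣ᵐ⁺ λ _ l∈p → xS-∣ᵐ⁻ ∣ᵐ-refl (p⊆q l∈p)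

xS-∪ : (p q : Subset n) → xS (p ∪ q) ∣ᵐ (xS p *ᵐ xS q)
xS-∪ p q = xS-∣ᵐ⁺ λ l l∈p∪q →
  [ (λ l∈p → ≤-trans (xS-∣ᵐ⁻ ∣ᵐ-refl l∈p) (m≤m+n _ _)) ,
    (λ l∈q → ≤-trans (xS-∣ᵐ⁻ ∣ᵐ-refl l∈q) (m≤n+m _ _)) ]′ (x∈p∪q⁻ p q l∈p∪q)

xS-∪⁅⁆ : w ∉ p → (xS p *ᵐ var w) ∣ᵐ xS (p ∪ ⁅ w ⁆)
xS-∪⁅⁆ {w = w} {p = p} w∉p l with l ≟ᶠ w
... | yes refl = ≤-reflexive (trans (cong₂ _+_ (xS-∉ w∉p) (xS-∈ (x∈⁅x⁆ w)))
                                    (≡.sym (xS-∈ (y∈p∪⁅y⁆ {p = p}))))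
... | no l≢w = ≤-trans (≤-reflexive (trans (cong (xS p l +_) (xS-∉ (x≢y⇒x∉⁅y⁆ l≢w))) (+-identityʳ _)))
                       (xS-mono {p = p} (p⊆p∪⁅y⁆ {y = w}) l)

UpwardClosed : MonIdeal n → Set
UpwardClosed I = ∀ {a b} → a ∣ᵐ b → I a → I b

LcmQuotient : Mon n → MonIdeal n → MonIdeal n → MonIdeal n
LcmQuotient c I K m = ∃ λ a → ∃ λ b → I a × K b × (lcmᵐ a b /ᵐ c) ∣ᵐ m

LcmQuotient-intro : {I K : MonIdeal n} → I a → K b → a ∣ᵐ (c *ᵐ m) → b ∣ᵐ (c *ᵐ m)
                  → LcmQuotient c I K m
LcmQuotient-intro {c = c} Ia Kb a∣cm b∣cm =
  _ , _ , Ia , Kb , proj₂ (/ᵐ-∣ᵐ⇔∣ᵐ-*ᵐ _ c) (lcmᵐ-least a∣cm b∣cm)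

∩ᴵ≐·ᴵLcmQuotient : {I K : MonIdeal n} → UpwardClosed I → UpwardClosed K → (∀ {a} → I a → c ∣ᵐ a)
                 → (I ∩ᴵ K) ≐ (c ·ᴵ LcmQuotient c I K)
∩ᴵ≐·ᴵLcmQuotient {c = c} {I = I} {K = K} I↑ K↑ c∣I m = to , from
  where
  to : (I ∩ᴵ K) m → (c ·ᴵ LcmQuotient c I K) m
  to (Im , Km) = m /ᵐ c , LcmQuotient-intro Im Km m∣c[m/c] m∣c[m/c] , *ᵐ-/ᵐ-cancel (c∣I Im)
    where
    m∣c[m/c] : m ∣ᵐ (c *ᵐ (m /ᵐ c))
    m∣c[m/c] = proj₁ (/ᵐ-∣ᵐ⇔∣ᵐ-*ᵐ m c) ∣ᵐ-refl
  from : (c ·ᴵ LcmQuotient c I K) m → (I ∩ᴵ K) m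
  from (g , (a , b , Ia , Kb , lcm/c∣g) , cg∣m) =
    I↑ (∣ᵐ-trans a∣ᵐlcmᵐ lcm∣m) Ia , K↑ (∣ᵐ-trans b∣ᵐlcmᵐ lcm∣m) Kb
    where
    lcm∣m : lcmᵐ a b ∣ᵐ m
    lcm∣m = ∣ᵐ-trans (proj₁ (/ᵐ-∣ᵐ⇔∣ᵐ-*ᵐ (lcmᵐ a b) c) lcm/c∣g) cg∣m

module _ (G : Graph n) where

  InN? : ∀ v p → Dec (InN G v p)
  InN? v p = ¬? (v ∈? p) ×-dec any? (λ u → (u ∈? p) ×-dec adj? G v u)

  WalkIn-mono : p ⊆ q → WalkIn G p u v → WalkIn G q u v
  WalkIn-mono p⊆q (here u∈p)        = here (p⊆q u∈p)
  WalkIn-mono p⊆q (step u∈p u~ walk) = step (p⊆q u∈p) u~ (WalkIn-mono p⊆q walk)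

  WalkIn-++ : WalkIn G p u v → WalkIn G p v w → WalkIn G p u w
  WalkIn-++ (here _)           walk′ = walk′
  WalkIn-++ (step u∈p u~ walk) walk′ = step u∈p u~ (WalkIn-++ walk walk′)

  WalkIn-exits : WalkIn G q u v → u ∉ p → v ∈ p → ∃ λ y → y ∈ q × InN G y p
  WalkIn-exits (here _) u∉p u∈p = contradiction u∈p u∉p
  WalkIn-exits {p = p} (step {v = y} u∈q u~y walk) u∉p v∈p with y ∈? p
  ... | yes y∈p = _ , u∈q , u∉p , y , y∈p , u~y
  ... | no y∉p  = WalkIn-exits walk y∉p v∈p

  Connected-inside : Connected G q → u ∈ q → u ∈ p → ¬ (∃ λ y → y ∈ q × InN G y p) → q ⊆ p
  Connected-inside {p = p} conn u∈q u∈p no-exit {z} z∈q = decidable-stable (z ∈? p) λ z∉p →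
    no-exit (WalkIn-exits (conn z _ z∈q u∈q) z∉p u∈p)

  Connected-∪-neighbour : Connected G p → InN G u p → Connected G (p ∪ ⁅ u ⁆)
  Connected-∪-neighbour {p = p} {u = u} conn (_ , y , y∈p , u~y) z z′ z∈ z′∈ =
    WalkIn-++ (to-y z∈) (from-y z′∈)
    where
    to-y : ∀ {z} → z ∈ p ∪ ⁅ u ⁆ → WalkIn G (p ∪ ⁅ u ⁆) z y
    to-y z∈ with x∈p∪⁅y⁆⁻ z∈
    ... | inj₁ z∈p = WalkIn-mono p⊆p∪⁅y⁆ (conn _ y z∈p y∈p)
    ... | inj₂ refl = step z∈ u~y (here (p⊆p∪⁅y⁆ y∈p))
    from-y : ∀ {z} → z ∈ p ∪ ⁅ u ⁆ → WalkIn G (p ∪ ⁅ u ⁆) y z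
    from-y z∈ with x∈p∪⁅y⁆⁻ z∈
    ... | inj₁ z∈p = WalkIn-mono p⊆p∪⁅y⁆ (conn y _ y∈p z∈p)
    ... | inj₂ refl = step (p⊆p∪⁅y⁆ y∈p) (Graph.sym G u~y) (here z∈)

  InN-∪⁅⁆⇔ : InN G v (p ∪ ⁅ w ⁆) ⇔ (v ∉ p × v ≢ w × (InN G v p ⊎ Adj G v w))
  InN-∪⁅⁆⇔ {v = v} {p = p} {w = w} = to , from
    where
    to : InN G v (p ∪ ⁅ w ⁆) → v ∉ p × v ≢ w × (InN G v p ⊎ Adj G v w)
    to (v∉ , u , u∈ , v~u) with x∉p∪⁅y⁆⁻ v∉
    ... | v∉p , v≢w = v∉p , v≢w , [ (λ u∈p → inj₁ (v∉p , u , u∈p , v~u)) ,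
                                    (λ { refl → inj₂ v~u }) ]′ (x∈p∪⁅y⁆⁻ u∈)
    from : v ∉ p × v ≢ w × (InN G v p ⊎ Adj G v w) → InN G v (p ∪ ⁅ w ⁆)
    from (v∉p , v≢w , inj₁ (_ , u , u∈p , v~u)) = x∉p∪⁅y⁆ v∉p v≢w , u , p⊆p∪⁅y⁆ u∈p , v~u
    from (v∉p , v≢w , inj₂ v~w)                 = x∉p∪⁅y⁆ v∉p v≢w , w , y∈p∪⁅y⁆ , v~w

  ¬InNc-∪⁅⁆ : ¬ InNc G v (p ∪ ⁅ w ⁆) → ¬ InNc G v p × ¬ InNv G v w
  ¬InNc-∪⁅⁆ {v = v} {p = p} {w = w} v∉N[] with x∉p∪⁅y⁆⁻ (v∉N[] ∘ inj₂)
  ... | v∉p , v≢w =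
    [ (λ v∈N → v∉N[] (inj₁ (from (v∉p , v≢w , inj₁ v∈N)))) , v∉p ]′ ,
    [ (λ v~w → v∉N[] (inj₁ (from (v∉p , v≢w , inj₂ v~w)))) , v≢w ]′
    where
    from : v ∉ p × v ≢ w × (InN G v p ⊎ Adj G v w) → InN G v (p ∪ ⁅ w ⁆)
    from = proj₂ InN-∪⁅⁆⇔

  extension-by-neighbour : Connected G q → u ∈ p → p ⊆ q → suc ∣ p ∣ ≡ ∣ q ∣
                         → ∃ λ y → InN G y p × p ∪ ⁅ y ⁆ ≡ q
  extension-by-neighbour {q = q} {p = p} conn u∈p p⊆q 1+∣p∣≡∣q∣
    with ∣p∣<∣q∣⇒∃[x∈q∖p] (≤-reflexive 1+∣p∣≡∣q∣)
  ... | y , y∈q , y∉p with WalkIn-exits (conn y _ y∈q (p⊆q u∈p)) y∉p u∈p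
  ...   | z , z∈q , z∈N = y , subst (λ v → InN G v p) z≡y z∈N , p∪y≡q
    where
    p∪y⊆q : p ∪ ⁅ y ⁆ ⊆ q
    p∪y⊆q v∈ = [ p⊆q , (λ { refl → y∈q }) ]′ (x∈p∪⁅y⁆⁻ v∈)
    p∪y≡q : p ∪ ⁅ y ⁆ ≡ q
    p∪y≡q = ⊆-antisym p∪y⊆q (p⊆q∧∣q∣≤∣p∣⇒q⊆p p∪y⊆q
              (≤-reflexive (trans (≡.sym 1+∣p∣≡∣q∣) (≡.sym (∣p∪⁅x⁆∣≡1+∣p∣ p y y∉p)))))
    z≡y : z ≡ y
    z≡y = [ (λ z∈p → contradiction z∈p (proj₁ z∈N)) , id ]′
            (x∈p∪⁅y⁆⁻ (subst (z ∈_) (≡.sym p∪y≡q) z∈q))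

  module _ {x : Fin n} (simplicial : Simplicial G x) where

    WalkIn-bypass : WalkIn G p u v → u ≢ x → v ≢ x → WalkIn G (p - x) u v
    WalkIn-bypass-from : u ∈ p → Adj G u x → WalkIn G p x v → u ≢ x → v ≢ x → WalkIn G (p - x) u v

    WalkIn-bypass (here u∈p) u≢x _ = here (x∈p∧x≢y⇒x∈p-y u∈p u≢x)
    WalkIn-bypass (step {v = y} u∈p u~y walk) u≢x v≢x with y ≟ᶠ x
    ... | no y≢x  = step (x∈p∧x≢y⇒x∈p-y u∈p u≢x) u~y (WalkIn-bypass walk y≢x v≢x)
    ... | yes refl = WalkIn-bypass-from u∈p u~y walk u≢x v≢x

    WalkIn-bypass-from _ _ (here _) _ v≢x = contradiction refl v≢x
    WalkIn-bypass-from {u = u} u∈p u~x (step {v = y} _ x~y walk) u≢x v≢x with y ≟ᶠ u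
    ... | yes refl = WalkIn-bypass walk u≢x v≢x
    ... | no y≢u  = step (x∈p∧x≢y⇒x∈p-y u∈p u≢x) (simplicial u y (Graph.sym G u~x) x~y (y≢u ∘ ≡.sym))
                         (WalkIn-bypass walk (λ { refl → Graph.irrefl G x~y }) v≢x)

    Connected-remove-simplicial : Connected G p → Connected G (p - x)
    Connected-remove-simplicial {p = p} conn u v u∈ v∈ =
      WalkIn-bypass (conn u v (p─q⊆p p ⁅ x ⁆ u∈) (p─q⊆p p ⁅ x ⁆ v∈)) (≢x u∈) (≢x v∈)
      where
      ≢x : ∀ {z} → z ∈ p - x → z ≢ x
      ≢x z∈ refl = x∉p-x p x z∈

  IsEdgeH-∪-neighbour : ∀ {t} → IsEdgeH G t p → InN G u p → IsEdgeH G (suc t) (p ∪ ⁅ u ⁆)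
  IsEdgeH-∪-neighbour {p = p} {u = u} (∣p∣≡t , conn) u∈N =
    trans (∣p∪⁅x⁆∣≡1+∣p∣ p u (proj₁ u∈N)) (cong suc ∣p∣≡t) , Connected-∪-neighbour conn u∈N

  IsEdgeH-remove-simplicial : ∀ {t x} → Simplicial G x → x ∈ p → IsEdgeH G (suc t) p
                            → IsEdgeH G t (p - x)
  IsEdgeH-remove-simplicial {p = p} {x = x} simplicial x∈p (∣p∣≡1+t , conn) =
    suc-injective (trans (x∈p⇒1+∣p-x∣≡∣p∣ p x x∈p) ∣p∣≡1+t) , Connected-remove-simplicial simplicial conn

  IHminus-upward : ∀ t {k} (Cs : Fin k → Subset n) P → UpwardClosed (IHminus G t Cs P)
  IHminus-upward _ _ _ a∣b (E , E-edge , E-avoids , E∣a) = E , E-edge , E-avoids , ∣ᵐ-trans E∣a a∣b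

  Jᵢ-upward : ∀ {k} (Cs : Fin k → Subset n) i → UpwardClosed (Jᵢ G Cs i)
  Jᵢ-upward _ _ a∣b (w , w∈B , Cw∣a) = w , w∈B , ∣ᵐ-trans Cw∣a a∣b

module Splitting (G : Graph n) (s : ℕ) (x : Fin n) {k : ℕ} (Cs : Fin k → Subset n)
            (Cs∈𝒜ₓ : ∀ j → InA G (suc s) x (Cs j)) (i : Fin k) where

  C : Subset n
  C = Cs i

  x∈Cs : ∀ j → x ∈ Cs j
  x∈Cs j = proj₁ (proj₂ (Cs∈𝒜ₓ j))

  Cs-edge : ∀ j → IsEdgeH G s (Cs j)
  Cs-edge j = proj₁ (Cs∈𝒜ₓ j) , proj₂ (proj₂ (Cs∈𝒜ₓ j))

  C∪⁅w⁆-edge : InN G w C → IsEdgeH G (suc s) (C ∪ ⁅ w ⁆)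
  C∪⁅w⁆-edge = IsEdgeH-∪-neighbour G (Cs-edge i)

  edge-⊇Cs : ∀ {E} j → IsEdgeH G (suc s) E → Cs j ⊆ E → ∃ λ u → InN G u (Cs j) × Cs j ∪ ⁅ u ⁆ ≡ E
  edge-⊇Cs j (∣E∣≡1+s , conn) Cj⊆E =
    extension-by-neighbour G conn (x∈Cs j) Cj⊆E (trans (cong suc (proj₁ (Cs-edge j))) (≡.sym ∣E∣≡1+s))

  edge∌x∈Kᵢ : ∀ {E} → IsEdgeH G (suc s) E → x ∉ E → Kᵢ G (suc s) Cs i (xS E)
  edge∌x∈Kᵢ {E} E-edge x∉E = E , E-edge , (λ j _ Cj⊆E → x∉E (Cj⊆E (x∈Cs j))) , ∣ᵐ-refl

  J⊆Prev : Jᵢ G Cs i m → Prevᵢ G (suc s) Cs i m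
  J⊆Prev (w , (w∈N , w∈B) , Cw∣m) =
    C ∪ ⁅ w ⁆ , C∪⁅w⁆-edge w∈N , avoids , ∣ᵐ-trans (xS-∪ C ⁅ w ⁆) Cw∣m
    where
    avoids : ∀ j → j <ᶠ i → ¬ (Cs j ⊆ C ∪ ⁅ w ⁆)
    avoids j j<i Cj⊆ with edge-⊇Cs j (C∪⁅w⁆-edge w∈N) Cj⊆
    ... | u , u∈N , Cj∪u≡C∪w = w∈B j j<i u u∈N (≡.sym Cj∪u≡C∪w)

  Prev⊆J+K : Prevᵢ G (suc s) Cs i m → (Jᵢ G Cs i +ᴵ Kᵢ G (suc s) Cs i) m
  Prev⊆J+K (E , E-edge , E-avoids , E∣m) with C ⊆? E
  ... | no C⊈E = inj₂ (E , E-edge , avoids , E∣m)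
    where
    avoids : ∀ j → j <ᶠ i ⊎ j ≡ i → ¬ (Cs j ⊆ E)
    avoids j (inj₁ j<i) = E-avoids j j<i
    avoids j (inj₂ refl) = C⊈E
  ... | yes C⊆E with edge-⊇Cs i E-edge C⊆E
  ...   | w , w∈N , refl = inj₁ (w , (w∈N , w∈B) , ∣ᵐ-trans (xS-∪⁅⁆ (proj₁ w∈N)) E∣m)
    where
    w∈B : ∀ j → j <ᶠ i → ∀ w′ → InN G w′ (Cs j) → C ∪ ⁅ w ⁆ ≢ Cs j ∪ ⁅ w′ ⁆
    w∈B j j<i w′ _ C∪w≡Cj∪w′ = E-avoids j j<i (subst (Cs j ⊆_) (≡.sym C∪w≡Cj∪w′) p⊆p∪⁅y⁆)

  Jᵢ+Kᵢ≐Prevᵢ : (Jᵢ G Cs i +ᴵ Kᵢ G (suc s) Cs i) ≐ Prevᵢ G (suc s) Cs i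
  Jᵢ+Kᵢ≐Prevᵢ _ = [ J⊆Prev , K⊆Prev ]′ , Prev⊆J+K
    where
    K⊆Prev : Kᵢ G (suc s) Cs i m → Prevᵢ G (suc s) Cs i m
    K⊆Prev (E , E-edge , E-avoids , E∣m) = E , E-edge , (λ j j<i → E-avoids j (inj₁ j<i)) , E∣m

  Jᵢ∩Kᵢ≐xCᵢ·Lᵢ : (Jᵢ G Cs i ∩ᴵ Kᵢ G (suc s) Cs i) ≐ (xS C ·ᴵ Lᵢ G (suc s) Cs i)
  Jᵢ∩Kᵢ≐xCᵢ·Lᵢ = ∩ᴵ≐·ᴵLcmQuotient (Jᵢ-upward G Cs i) (IHminus-upward G (suc s) Cs _)
                   (λ (w , _ , Cw∣a) → ∣ᵐ-trans (a∣ᵐa*ᵐb (xS C) (var w)) Cw∣a)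

  edge-misses-C∪⁅w⁆ : ∀ {E} → InN G w C → IsEdgeH G (suc s) E → ¬ (C ⊆ E)
                    → ¬ (∃ λ l → l ∈ E × InN G l (C ∪ ⁅ w ⁆)) → ∀ {l} → l ∈ E → l ∉ C ∪ ⁅ w ⁆
  edge-misses-C∪⁅w⁆ {w = w} {E = E} w∈N (∣E∣≡1+s , conn) C⊈E no-exit l∈E l∈C∪w = C⊈E (C∪w⊆E ∘ p⊆p∪⁅y⁆)
    where
    C∪w⊆E : C ∪ ⁅ w ⁆ ⊆ E
    C∪w⊆E = p⊆q∧∣q∣≤∣p∣⇒q⊆p (Connected-inside G conn l∈E l∈C∪w no-exit)
              (≤-reflexive (trans (proj₁ (C∪⁅w⁆-edge w∈N)) (≡.sym ∣E∣≡1+s)))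

  MN-intro : InN G v (C ∪ ⁅ w ⁆) → var v ∣ᵐ m → (Mᵢ G Cs i w +ᴵ Nᵢ G Cs i w) m
  MN-intro {v = v} {w = w} v∈N v∣m with proj₁ (InN-∪⁅⁆⇔ G {v = v} {p = C} {w = w}) v∈N
  ... | _ , v≢w , inj₁ v∈NC = inj₁ (v , v∈NC , v≢w , v∣m)
  ... | v∉C , v≢w , inj₂ v~w with InN? G v C
  ...   | yes v∈NC = inj₁ (v , v∈NC , v≢w , v∣m)
  ...   | no v∉NC  = inj₂ (v , v~w , [ v∉NC , v∉C ]′ , v∣m)

  colon⊆MNQ : InB G Cs i w → (Lᵢ G (suc s) Cs i ∶var w) m
            → ((Mᵢ G Cs i w +ᴵ Nᵢ G Cs i w) +ᴵ Qᵢ G (suc s) Cs i w) m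
  colon⊆MNQ {w = w} {m = m} (w∈N , _)
            (a , b , (w′ , (w′∈N , _) , Cw′∣a) , (E , E-edge , E-avoids , E∣b) , lcm/C∣) = result
    where
    A : Subset n
    A = C ∪ ⁅ w ⁆

    in-m : ∀ {S l} → xS S ∣ᵐ lcmᵐ a b → l ∈ S → l ∉ C → l ≢ w → 1 ≤ m l
    in-m S∣lcm l∈S l∉C l≢w =
      subst (1 ≤_) (cong₂ _+_ (xS-∉ l∉C) (cong (_+ m _) (xS-∉ {p = ⁅ w ⁆} (x≢y⇒x∉⁅y⁆ l≢w))))
            (xS-∣ᵐ⁻ (∣ᵐ-trans S∣lcm (proj₁ (/ᵐ-∣ᵐ⇔∣ᵐ-*ᵐ (lcmᵐ a b) (xS C)) lcm/C∣)) l∈S)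

    w′∣lcm : var w′ ∣ᵐ lcmᵐ a b
    w′∣lcm = ∣ᵐ-trans (b∣ᵐa*ᵐb (xS C) (var w′)) (∣ᵐ-trans Cw′∣a a∣ᵐlcmᵐ)

    E∣lcm : xS E ∣ᵐ lcmᵐ a b
    E∣lcm = ∣ᵐ-trans E∣b b∣ᵐlcmᵐ

    result : ((Mᵢ G Cs i w +ᴵ Nᵢ G Cs i w) +ᴵ Qᵢ G (suc s) Cs i w) m
    result with w′ ≟ᶠ w
    ... | no w′≢w = inj₁ (inj₁ (w′ , w′∈N , w′≢w , var-∣ᵐ (in-m w′∣lcm (x∈⁅x⁆ w′) (proj₁ w′∈N) w′≢w)))
    ... | yes _ with any? (λ l → l ∈? E ×-dec InN? G l A)
    ...   | yes (l , l∈E , l∈N) with proj₁ (InN-∪⁅⁆⇔ G) l∈N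
    ...     | l∉C , l≢w , _ = inj₁ (MN-intro l∈N (var-∣ᵐ (in-m E∣lcm l∈E l∉C l≢w)))
    result | yes _ | no E∩N[A]=∅ =
      inj₂ (E , E-edge , E-outside , xS-∣ᵐ⁺ λ l l∈E → uncurry (in-m E∣lcm l∈E) (x∉p∪⁅y⁆⁻ (E∩A=∅ l∈E)))
      where
      E∩A=∅ : ∀ {l} → l ∈ E → l ∉ A
      E∩A=∅ = edge-misses-C∪⁅w⁆ w∈N E-edge (E-avoids i (inj₂ refl)) E∩N[A]=∅
      E-outside : ∀ l → l ∈ E → ¬ InNc G l C × ¬ InNv G l w
      E-outside l l∈E = ¬InNc-∪⁅⁆ G [ (λ l∈N → E∩N[A]=∅ (l , l∈E , l∈N)) , E∩A=∅ l∈E ]′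

  Lᵢ-intro : Jᵢ G Cs i a → Kᵢ G (suc s) Cs i b → a ∣ᵐ (xS C *ᵐ m) → b ∣ᵐ (xS C *ᵐ m)
           → Lᵢ G (suc s) Cs i m
  Lᵢ-intro = LcmQuotient-intro {c = xS C}

  MNQ⊆colon : Simplicial G x → InB G Cs i w → ((Mᵢ G Cs i w +ᴵ Nᵢ G Cs i w) +ᴵ Qᵢ G (suc s) Cs i w) m
            → (Lᵢ G (suc s) Cs i ∶var w) m
  MNQ⊆colon {w = w} {m = m} simplicial w∈B = λ
    { (inj₁ (inj₁ (v , v∈NC , v≢w , v∣m)))  → via-neighbour (from (proj₁ v∈NC , v≢w , inj₁ v∈NC)) v∣m
    ; (inj₁ (inj₂ (v , v~w , v∉N[C] , v∣m))) →
        via-neighbour (from (v∉N[C] ∘ inj₂ , (λ { refl → Graph.irrefl G v~w }) , inj₂ v~w)) v∣m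
    ; (inj₂ (D , D-edge , D-outside , D∣m)) →
        Lᵢ-intro Cw∈Jᵢ (edge∌x∈Kᵢ D-edge (λ x∈D → proj₁ (D-outside x x∈D) (inj₂ (x∈Cs i))))
                          Cw∣Cwm (∣ᵐ-trans D∣m (∣ᵐ-trans (b∣ᵐa*ᵐb (var w) m) (b∣ᵐa*ᵐb (xS C) _)))
    }
    where
    from : ∀ {v} → v ∉ C × v ≢ w × (InN G v C ⊎ Adj G v w) → InN G v (C ∪ ⁅ w ⁆)
    from = proj₂ (InN-∪⁅⁆⇔ G)

    Cw∈Jᵢ : Jᵢ G Cs i (xS C *ᵐ var w)
    Cw∈Jᵢ = w , w∈B , ∣ᵐ-refl

    Cw∣Cwm : (xS C *ᵐ var w) ∣ᵐ (xS C *ᵐ (var w *ᵐ m))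
    Cw∣Cwm = *ᵐ-mono-∣ᵐ (∣ᵐ-refl {a = xS C}) (a∣ᵐa*ᵐb (var w) m)

    via-neighbour : ∀ {v} → InN G v (C ∪ ⁅ w ⁆) → var v ∣ᵐ m → (Lᵢ G (suc s) Cs i ∶var w) m
    via-neighbour {v} v∈N v∣m =
      Lᵢ-intro Cw∈Jᵢ (edge∌x∈Kᵢ E-edge (x∉p-x _ x)) Cw∣Cwm E∣Cwm
      where
      E : Subset n
      E = ((C ∪ ⁅ w ⁆) ∪ ⁅ v ⁆) - x
      E-edge : IsEdgeH G (suc s) E
      E-edge = IsEdgeH-remove-simplicial G simplicial (p⊆p∪⁅y⁆ (p⊆p∪⁅y⁆ (x∈Cs i)))
                 (IsEdgeH-∪-neighbour G (C∪⁅w⁆-edge (proj₁ w∈B)) v∈N)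
      E∣Cwm : xS E ∣ᵐ (xS C *ᵐ (var w *ᵐ m))
      E∣Cwm = ∣ᵐ-trans (xS-mono (p─q⊆p ((C ∪ ⁅ w ⁆) ∪ ⁅ v ⁆) ⁅ x ⁆))
              (∣ᵐ-trans (xS-∪ (C ∪ ⁅ w ⁆) ⁅ v ⁆)
              (∣ᵐ-trans (*ᵐ-mono-∣ᵐ (xS-∪ C ⁅ w ⁆) v∣m) (*ᵐ-assoc-∣ᵐ (xS C) (var w) m)))

  Lᵢ∶w≐Mᵢ+Nᵢ+Qᵢ : Simplicial G x → ∀ w → InB G Cs i w
                → (Lᵢ G (suc s) Cs i ∶var w) ≐ ((Mᵢ G Cs i w +ᴵ Nᵢ G Cs i w) +ᴵ Qᵢ G (suc s) Cs i w)
  Lᵢ∶w≐Mᵢ+Nᵢ+Qᵢ simplicial _ w∈B _ = colon⊆MNQ w∈B , MNQ⊆colon simplicial w∈B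

lemma3p4 : {n : ℕ} (G : Graph n) → Chordal G → (t : ℕ) → 2 ≤ t
    → (x : Fin n) → Simplicial G x
    → (k : ℕ) (Cs : Fin k → Subset n)
    → (∀ i j → Cs i ≡ Cs j → i ≡ j)
    → (∀ C → InA G t x C ⇔ ∃ (λ i → Cs i ≡ C))
    → (i : Fin k) → ∃ (λ w → InB G Cs i w)
    → ((Jᵢ G Cs i +ᴵ Kᵢ G t Cs i) ≐ Prevᵢ G t Cs i)
      × ((Jᵢ G Cs i ∩ᴵ Kᵢ G t Cs i) ≐ (xS (Cs i) ·ᴵ Lᵢ G t Cs i))
      × (∀ w → InB G Cs i w
           → (Lᵢ G t Cs i ∶var w)
             ≐ ((Mᵢ G Cs i w +ᴵ Nᵢ G Cs i w) +ᴵ Qᵢ G t Cs i w))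
lemma3p4 G _ (suc s) (s≤s _) x simplicial k Cs _ enumerates i _ =
  Jᵢ+Kᵢ≐Prevᵢ , Jᵢ∩Kᵢ≐xCᵢ·Lᵢ , Lᵢ∶w≐Mᵢ+Nᵢ+Qᵢ simplicial
  where open Splitting G s x Cs (λ j → proj₂ (enumerates (Cs j)) (j , refl)) i
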